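{- For every positive integer $d$, every family $F$ of forbidden $d$-dimensional 0-1 matrices, and all positive integers $n, m, k$, we have $ex(n,m,F,d) \leq k\,(lx_{k}(n,m,F,d)+n^{d-1})$.
   Context: A $d$-dimensional 0-1 matrix with sidelengths $n_1,\dots,n_d$ is a function $[n_1]\times\cdots\times[n_d]\to\{0,1\}$; entries with value 1 are ones. $M$ contains $P$ if there are, for each dimension $i$, strictly increasing maps from the index set of $P$ in dimension $i$ into that of $M$ such that every one of $P$ is mapped to a one of $M$ (i.e. a submatrix of $M$ equals $P$ or becomes $P$ after changing some ones to zeroes); otherwise $M$ avoids $P$; $M$ avoids a family $F$ if it avoids every member. A $1$-row of a $d$-dimensional matrix is a set of entries all of whose coordinates other than the first coordinate are equal. $ex(n,m,F,d)$ is the maximum number of ones in an $F$-avoiding $d$-dimensional 0-1 matrix whose first dimension has length $m$ and other dimensions have length $n$. $lx_{k}(n,m,F,d)$ is the maximum possible number of distinct letters in a $d$-dimensional array with first dimension of length $m$ and other dimensions of length $n$, each entry blank or holding one letter, such that every letter has at least $k$ occurrences, all occurrences of each letter lie in the same $1$-row, and the 0-1 matrix obtained by replacing letters with ones and blanks with zeroes avoids all matrices in $F$. -}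

module Defs where

open import Data.Nat using (ℕ; zero; suc; _≤_; _<_; _+_; _*_; _^_)
import Data.Nat
open import Data.Fin using (Fin; zero; suc)
import Data.Fin as F
open import Data.Bool using (Bool; true; false; T)
open import Data.Maybe using (Maybe; just; nothing; is-just)
open import Data.List using (allFin; List; []; _∷_; length; concatMap; map; filter; mapMaybe; deduplicate)
open import Data.Product using (Σ; _×_; _,_; ∃)
open import Relation.Nullary using (¬_)
open import Relation.Nullary.Decidable using (does)
open import Relation.Binary.PropositionalEquality using (_≡_)

Shape : ℕ → Set
Shape d = Fin d → ℕ

Idx : {d : ℕ} → Shape d → Set
Idx {d} s = (i : Fin d) → Fin (s i)

Matrix : {d : ℕ} → Shape d → Set
Matrix s = Idx s → Bool

allIdx : {d : ℕ} (s : Shape d) → List (Idx s)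
allIdx {zero} s = (λ ()) ∷ []
allIdx {suc d} s =
  concatMap (λ a → map (λ x → cons a x) (allIdx (λ i → s (suc i)))) (allFin (s zero))
  where
  cons : Fin (s zero) → Idx (λ i → s (suc i)) → Idx s
  cons a x zero = a
  cons a x (suc i) = x i

ones : {d : ℕ} {s : Shape d} → Matrix s → ℕ
ones {s = s} M = length (filter (λ x → T? (M x)) (allIdx s))
  where
  open import Relation.Nullary.Decidable using () renaming (T? to T?)

StrictlyIncreasing : {a b : ℕ} → (Fin a → Fin b) → Set
StrictlyIncreasing f = ∀ x y → x F.< y → f x F.< f y

-- M contains P
Contains : {d : ℕ} {t s : Shape d} → Matrix t → Matrix s → Set
Contains {d} {t} {s} P M =
  Σ ((i : Fin d) → Fin (t i) → Fin (s i)) λ f →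
    ((i : Fin d) → StrictlyIncreasing (f i)) ×
    ((x : Idx t) → P x ≡ true → M (λ i → f i (x i)) ≡ true)

Family : ℕ → Set₁
Family d = (t : Shape d) → Matrix t → Set

Avoids : {d : ℕ} {s : Shape d} → Family d → Matrix s → Set
Avoids {d} F M = ∀ (t : Shape d) (P : Matrix t) → F t P → ¬ Contains P M

shape : (d' n m : ℕ) → Shape (suc d')
shape d' n m zero = m
shape d' n m (suc i) = n

IsMax : (ℕ → Set) → ℕ → Set
IsMax P e = P e × (∀ e' → P e' → e' ≤ e)

ExValue : (d' n m : ℕ) → Family (suc d') → ℕ → Set
ExValue d' n m F e = Σ (Matrix (shape d' n m)) λ M → Avoids F M × ones M ≡ e

-- ex(n,m,F,d) = e  (d = suc d')
IsEx : (d' n m : ℕ) → Family (suc d') → ℕ → Set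
IsEx d' n m F = IsMax (ExValue d' n m F)

-- letter arrays: each entry blank (nothing) or a letter (a natural number)
LetterArray : {d : ℕ} → Shape d → Set
LetterArray s = Idx s → Maybe ℕ

occurrences : {d : ℕ} {s : Shape d} → LetterArray s → ℕ → ℕ
occurrences {s = s} A a = length (filter (λ x → A x ≟M just a) (allIdx s))
  where
  open import Data.Maybe.Properties using () renaming (≡-dec to ≡-decM)
  _≟M_ = ≡-decM Data.Nat._≟_

distinctLetters : {d : ℕ} {s : Shape d} → LetterArray s → ℕ
distinctLetters {s = s} A = length (deduplicate Data.Nat._≟_ (mapMaybe A (allIdx s)))

underlying : {d : ℕ} {s : Shape d} → LetterArray s → Matrix s
underlying A x = is-just (A x)

ValidLx : (d' : ℕ) {s : Shape (suc d')} → ℕ → Family (suc d') → LetterArray s → Set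
ValidLx d' {s} k F A =
  (∀ (x : Idx s) (a : ℕ) → A x ≡ just a → k ≤ occurrences A a) ×
  (∀ (x y : Idx s) (a : ℕ) → A x ≡ just a → A y ≡ just a → ∀ (i : Fin d') → x (suc i) ≡ y (suc i)) ×
  Avoids F (underlying A)

LxValue : (d' n m k : ℕ) → Family (suc d') → ℕ → Set
LxValue d' n m k F l = Σ (LetterArray (shape d' n m)) λ A → ValidLx d' k F A × distinctLetters A ≡ l

-- lx_k(n,m,F,d) = l  (d = suc d')
IsLx : (d' n m k : ℕ) → Family (suc d') → ℕ → Set
IsLx d' n m k F = IsMax (LxValue d' n m k F)

-- In every 1-row take the ones in order of their first coordinate and cut them into
-- consecutive blocks of k; every complete block gets a letter of its own, and the at most
-- k - 1 ones left over in a row stay blank. Each letter then occurs k times inside one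
-- 1-row, and the ones of the array are ones of M, so the array is admissible for lx_k and
-- has at most lx_k(n,m,F,d) letters. A row with r ones carries floor(r/k) letters and
-- r <= k floor(r/k) + k ones; summing over the n^(d-1) rows gives ex <= k (lx_k + n^(d-1)).

module Submission where

open import Defs
open import Data.Nat using (ℕ; zero; suc; _≤_; _<_; _+_; _*_; _^_; _∸_; z≤n; s≤s; _≟_; _<?_; NonZero)
open import Data.Nat.Properties
open import Data.Nat.DivMod
open import Data.Nat.ListAction using (sum)
open import Data.Nat.ListAction.Properties using (sum-++)
open import Data.Bool using (Bool; true; false; if_then_else_; _∨_)
open import Data.Fin using (toℕ; zero; suc)
open import Data.Fin.Properties using (toℕ<n; toℕ-injective)
open import Data.Vec.Functional using (tail)
open import Data.Maybe using (Maybe; just; nothing; maybe′)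
open import Data.Maybe.Properties using (≡-dec; just-injective)
open import Data.Product using (_×_; _,_; ∃; proj₁; proj₂)
open import Data.Empty using (⊥-elim)
open import Data.List using (List; []; _∷_; [_]; _++_; _∷ʳ_; length; map; filter; concatMap; applyUpTo; upTo; allFin; tabulate; mapMaybe; deduplicate)
open import Data.List.Properties using (∷-injective; map-++; map-∘; map-cong; map-cong-local; map-upTo; upTo-∷ʳ; map-tabulate; map-concatMap; concatMap-map; concatMap-cong)
open import Data.List.Relation.Unary.Any using (here; there)
import Data.List.Relation.Unary.All as All
open import Data.List.Membership.Propositional using (_∈_)
open import Data.List.Membership.Propositional.Properties using (∈-upTo⁺; ∈-map⁻; ∈-deduplicate⁺)
open import Data.List.Membership.DecPropositional _≟_ using (_∈?_)
open import Function using (_∘_; id)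
open import Level using (0ℓ)
open import Relation.Unary using (Pred; Decidable)
open import Relation.Nullary using (Dec; yes; no; does)
open import Relation.Nullary.Decidable using (dec-true; dec-false; T?)
open import Relation.Binary.Definitions using (DecidableEquality)
open import Relation.Binary.PropositionalEquality hiding ([_])
open import Algebra.Properties.CommutativeSemigroup +-commutativeSemigroup
  using () renaming (interchange to +-interchange)

𝟙 : Bool → ℕ
𝟙 true  = 1
𝟙 false = 0

𝟙≤1 : ∀ b → 𝟙 b ≤ 1
𝟙≤1 true  = s≤s z≤n
𝟙≤1 false = z≤n

𝟙-∨ : ∀ a b → 𝟙 (a ∨ b) ≤ 𝟙 a + 𝟙 b
𝟙-∨ true  b = s≤s z≤n
𝟙-∨ false b = ≤-refl

𝟙-mono : ∀ {P Q : Set} (P? : Dec P) (Q? : Dec Q) → (P → Q) → 𝟙 (does P?) ≤ 𝟙 (does Q?)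
𝟙-mono (no _)  _       _   = z≤n
𝟙-mono (yes p) (yes _) _   = ≤-refl
𝟙-mono (yes p) (no ¬q) p→q = ⊥-elim (¬q (p→q p))

𝟙-positive : ∀ {P : Set} (P? : Dec P) → 0 < 𝟙 (does P?) → P
𝟙-positive (yes p) _ = p

-- Finite sums over initial segments of ℕ

∑ : ℕ → (ℕ → ℕ) → ℕ
∑ zero    f = 0
∑ (suc n) f = ∑ n f + f n

syntax ∑ n (λ i → e) = ∑[ i < n ] e

module _ {n : ℕ} {f g : ℕ → ℕ} where

  ∑-cong : (∀ i → i < n → f i ≡ g i) → ∑ n f ≡ ∑ n g
  ∑-cong = go n
    where
    go : ∀ n → (∀ i → i < n → f i ≡ g i) → ∑ n f ≡ ∑ n g
    go zero    _   = refl
    go (suc n) f≡g = cong₂ _+_ (go n (λ i i<n → f≡g i (m<n⇒m<1+n i<n))) (f≡g n ≤-refl)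

  ∑-monoʳ-≤ : (∀ i → i < n → f i ≤ g i) → ∑ n f ≤ ∑ n g
  ∑-monoʳ-≤ = go n
    where
    go : ∀ n → (∀ i → i < n → f i ≤ g i) → ∑ n f ≤ ∑ n g
    go zero    _   = z≤n
    go (suc n) f≤g = +-mono-≤ (go n (λ i i<n → f≤g i (m<n⇒m<1+n i<n))) (f≤g n ≤-refl)

∑-distrib-+ : ∀ n (f g : ℕ → ℕ) → ∑[ i < n ] (f i + g i) ≡ ∑ n f + ∑ n g
∑-distrib-+ zero    f g = refl
∑-distrib-+ (suc n) f g = begin
  ∑[ i < n ] (f i + g i) + (f n + g n) ≡⟨ cong (_+ (f n + g n)) (∑-distrib-+ n f g) ⟩
  (∑ n f + ∑ n g) + (f n + g n)        ≡⟨ +-interchange (∑ n f) (∑ n g) (f n) (g n) ⟩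
  (∑ n f + f n) + (∑ n g + g n)        ∎
  where open ≡-Reasoning

∑-const : ∀ n c → ∑[ i < n ] c ≡ n * c
∑-const zero    c = refl
∑-const (suc n) c = trans (cong (_+ c) (∑-const n c)) (+-comm (n * c) c)

∑-zero : ∀ n {f : ℕ → ℕ} → (∀ i → i < n → f i ≡ 0) → ∑ n f ≡ 0
∑-zero n f≡0 = trans (∑-cong f≡0) (trans (∑-const n 0) (*-zeroʳ n))

*-distribˡ-∑ : ∀ k n (f : ℕ → ℕ) → k * ∑ n f ≡ ∑[ i < n ] (k * f i)
*-distribˡ-∑ k zero    f = *-zeroʳ k
*-distribˡ-∑ k (suc n) f =
  trans (*-distribˡ-+ k (∑ n f) (f n)) (cong (_+ k * f n) (*-distribˡ-∑ k n f))

∑-comm : ∀ m n (f : ℕ → ℕ → ℕ) → ∑[ i < m ] ∑[ j < n ] f i j ≡ ∑[ j < n ] ∑[ i < m ] f i j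
∑-comm zero    n f = sym (∑-zero n (λ _ _ → refl))
∑-comm (suc m) n f = begin
  ∑[ i < m ] ∑[ j < n ] f i j + ∑[ j < n ] f m j ≡⟨ cong (_+ ∑[ j < n ] f m j) (∑-comm m n f) ⟩
  ∑[ j < n ] ∑[ i < m ] f i j + ∑[ j < n ] f m j ≡⟨ ∑-distrib-+ n (λ j → ∑[ i < m ] f i j) (f m) ⟨
  ∑[ j < n ] (∑[ i < m ] f i j + f m j)          ∎
  where open ≡-Reasoning

∑-+ : ∀ a b (f : ℕ → ℕ) → ∑ (a + b) f ≡ ∑ a f + ∑[ i < b ] f (a + i)
∑-+ a zero    f = trans (cong (λ t → ∑ t f) (+-identityʳ a)) (sym (+-identityʳ (∑ a f)))
∑-+ a (suc b) f = begin
  ∑ (a + suc b) f                                ≡⟨ cong (λ t → ∑ t f) (+-suc a b) ⟩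
  ∑ (a + b) f + f (a + b)                        ≡⟨ cong (_+ f (a + b)) (∑-+ a b f) ⟩
  ∑ a f + ∑[ i < b ] f (a + i) + f (a + b)       ≡⟨ +-assoc (∑ a f) _ _ ⟩
  ∑ a f + (∑[ i < b ] f (a + i) + f (a + b))     ∎
  where open ≡-Reasoning

∑-blocks : ∀ q b (f : ℕ → ℕ) → ∑ (q * b) f ≡ ∑[ i < q ] ∑[ j < b ] f (i * b + j)
∑-blocks zero    b f = refl
∑-blocks (suc q) b f = begin
  ∑ (b + q * b) f                                  ≡⟨ cong (λ t → ∑ t f) (+-comm b (q * b)) ⟩
  ∑ (q * b + b) f                                  ≡⟨ ∑-+ (q * b) b f ⟩
  ∑ (q * b) f + ∑[ j < b ] f (q * b + j)           ≡⟨ cong (_+ ∑[ j < b ] f (q * b + j)) (∑-blocks q b f) ⟩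
  ∑[ i < q ] ∑[ j < b ] f (i * b + j) + ∑[ j < b ] f (q * b + j) ∎
  where open ≡-Reasoning

∑-monoˡ-≤ : ∀ {a b} (f : ℕ → ℕ) → a ≤ b → ∑ a f ≤ ∑ b f
∑-monoˡ-≤ {a} {b} f a≤b = begin
  ∑ a f                                 ≤⟨ m≤m+n (∑ a f) _ ⟩
  ∑ a f + ∑[ i < b ∸ a ] f (a + i)      ≡⟨ ∑-+ a (b ∸ a) f ⟨
  ∑ (a + (b ∸ a)) f                     ≡⟨ cong (λ t → ∑ t f) (m+[n∸m]≡n a≤b) ⟩
  ∑ b f                                 ∎
  where open ≤-Reasoning

≤-∑ : ∀ {i n} (f : ℕ → ℕ) → i < n → f i ≤ ∑ n f
≤-∑ {i} f i<n = ≤-trans (m≤n+m (f i) (∑ i f)) (∑-monoˡ-≤ f i<n)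

∑-positive : ∀ n (f : ℕ → ℕ) → 0 < ∑ n f → ∃ λ i → i < n × 0 < f i
∑-positive zero    f ()
∑-positive (suc n) f 0<∑ with f n in fn≡
... | suc _ = n , ≤-refl , subst (0 <_) (sym fn≡) (s≤s z≤n)
... | zero  with i , i<n , 0<fi ← ∑-positive n f (subst (0 <_) (+-identityʳ (∑ n f)) 0<∑)
  = i , m<n⇒m<1+n i<n , 0<fi

∑-window : ∀ {f : ℕ → ℕ} t K B → t + K ≤ B → (∀ i → i < K → f (t + i) ≡ 1) → K ≤ ∑ B f
∑-window {f} t K B t+K≤B f≡1 = begin
  K                              ≡⟨ trans (∑-const K 1) (*-identityʳ K) ⟨
  ∑[ i < K ] 1                   ≡⟨ ∑-cong f≡1 ⟨
  ∑[ i < K ] f (t + i)           ≤⟨ m≤n+m _ (∑ t f) ⟩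
  ∑ t f + ∑[ i < K ] f (t + i)   ≡⟨ ∑-+ t K f ⟨
  ∑ (t + K) f                    ≤⟨ ∑-monoˡ-≤ f t+K≤B ⟩
  ∑ B f                          ∎
  where open ≤-Reasoning

≤-∑-<? : ∀ {g m} → g ≤ m → g ≤ ∑[ q < m ] 𝟙 (does (q <? g))
≤-∑-<? {g} {m} g≤m = begin
  g                              ≡⟨ trans (∑-const g 1) (*-identityʳ g) ⟨
  ∑[ q < g ] 1                   ≡⟨ ∑-cong (λ q q<g → cong 𝟙 (dec-true (q <? g) q<g)) ⟨
  ∑[ q < g ] 𝟙 (does (q <? g))   ≤⟨ ∑-monoˡ-≤ _ g≤m ⟩
  ∑[ q < m ] 𝟙 (does (q <? g))   ∎
  where open ≤-Reasoning

∑-≟-≤1 : ∀ B x → ∑[ j < B ] 𝟙 (does (j ≟ x)) ≤ 1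
∑-≟-≤1 zero    x = z≤n
∑-≟-≤1 (suc B) x with B ≟ x
... | no B≢x rewrite dec-false (B ≟ x) B≢x = subst (_≤ 1) (sym (+-identityʳ _)) (∑-≟-≤1 B x)
... | yes refl rewrite dec-true (B ≟ B) refl =
  ≤-reflexive (cong (_+ 1) (∑-zero B λ j j<B → cong 𝟙 (dec-false (j ≟ B) (<⇒≢ j<B))))

∑-∈-≤-length : ∀ (xs : List ℕ) B → ∑[ j < B ] 𝟙 (does (j ∈? xs)) ≤ length xs
∑-∈-≤-length []       B = ≤-reflexive (∑-zero B (λ _ _ → refl))
∑-∈-≤-length (x ∷ xs) B = begin
  ∑[ j < B ] 𝟙 (does (j ∈? x ∷ xs))                          ≤⟨ ∑-monoʳ-≤ {n = B} (λ j _ → 𝟙-∨ (does (j ≟ x)) (does (j ∈? xs))) ⟩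
  ∑[ j < B ] (𝟙 (does (j ≟ x)) + 𝟙 (does (j ∈? xs)))         ≡⟨ ∑-distrib-+ B _ _ ⟩
  ∑[ j < B ] 𝟙 (does (j ≟ x)) + ∑[ j < B ] 𝟙 (does (j ∈? xs)) ≤⟨ +-mono-≤ (∑-≟-≤1 B x) (∑-∈-≤-length xs B) ⟩
  1 + length xs                                                ∎
  where open ≤-Reasoning

∑-≤-length : ∀ {N Q} (g : ℕ → ℕ) (xs : List ℕ) → (∀ c → c < N → g c ≤ Q) →
             (∀ c q → c < N → q < g c → q * N + c ∈ xs) → ∑[ c < N ] g c ≤ length xs
∑-≤-length {N} {Q} g xs g≤Q letters = begin
  ∑[ c < N ] g c                                        ≤⟨ ∑-monoʳ-≤ {n = N} (λ c c<N → ≤-∑-<? (g≤Q c c<N)) ⟩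
  ∑[ c < N ] ∑[ q < Q ] 𝟙 (does (q <? g c))             ≡⟨ ∑-comm N Q _ ⟩
  ∑[ q < Q ] ∑[ c < N ] 𝟙 (does (q <? g c))             ≤⟨ ∑-monoʳ-≤ {n = Q} (λ q _ → ∑-monoʳ-≤ {n = N} λ c c<N →
                                                            𝟙-mono (q <? g c) (q * N + c ∈? xs) (letters c q c<N)) ⟩
  ∑[ q < Q ] ∑[ c < N ] 𝟙 (does (q * N + c ∈? xs))      ≡⟨ ∑-blocks Q N _ ⟨
  ∑[ j < Q * N ] 𝟙 (does (j ∈? xs))                     ≤⟨ ∑-∈-≤-length xs (Q * N) ⟩
  length xs                                             ∎
  where open ≤-Reasoning

divMod-unique : ∀ a a′ {P c c′} → c < P → c′ < P → a * P + c ≡ a′ * P + c′ → a ≡ a′ × c ≡ c′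
divMod-unique zero    zero     _   _    eq = refl , eq
divMod-unique zero    (suc a′) {P} c<P _ eq =
  ⊥-elim (<⇒≱ c<P (subst (P ≤_) (sym eq) (≤-trans (m≤m+n P (a′ * P)) (m≤m+n _ _))))
divMod-unique (suc a) zero     {P} _ c′<P eq =
  ⊥-elim (<⇒≱ c′<P (subst (P ≤_) eq (≤-trans (m≤m+n P (a * P)) (m≤m+n _ _))))
divMod-unique (suc a) (suc a′) {P} c<P c′<P eq
  with refl , refl ← divMod-unique a a′ c<P c′<P
                      (+-cancelˡ-≡ P _ _ (trans (sym (+-assoc P _ _)) (trans eq (+-assoc P _ _))))
  = refl , refl

[m*n+o]/n≡m : ∀ m {n o} .{{_ : NonZero n}} → o < n → (m * n + o) / n ≡ m
[m*n+o]/n≡m m {n} {o} o<n = proj₁ (divMod-unique (x / n) m (m%n<n x n) o<n (sym x≡))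
  where
  x = m * n + o
  x≡ : x ≡ x / n * n + x % n
  x≡ = trans (m≡m%n+[m/n]*n x n) (+-comm (x % n) _)

m≤n*[m/n]+n : ∀ m n .{{_ : NonZero n}} → m ≤ n * (m / n) + n
m≤n*[m/n]+n m n = begin
  m                    ≡⟨ m≡m%n+[m/n]*n m n ⟩
  m % n + m / n * n    ≤⟨ +-monoˡ-≤ (m / n * n) (m%n≤n m n) ⟩
  n + m / n * n        ≡⟨ +-comm n (m / n * n) ⟩
  m / n * n + n        ≡⟨ cong (_+ n) (*-comm (m / n) n) ⟩
  n * (m / n) + n      ∎
  where open ≤-Reasoning

*+<* : ∀ {a m c P} → a < m → c < P → a * P + c < m * P
*+<* {a} {m} {c} {P} a<m c<P = begin-strict
  a * P + c      <⟨ +-monoʳ-< (a * P) c<P ⟩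
  a * P + P      ≡⟨ +-comm (a * P) P ⟩
  suc a * P      ≤⟨ *-monoˡ-≤ P a<m ⟩
  m * P          ∎
  where open ≤-Reasoning

module Rank (f : ℕ → Bool) where

  rank : ℕ → ℕ
  rank a = ∑[ i < a ] 𝟙 (f i)

  rank≤ : ∀ a → rank a ≤ a
  rank≤ a = begin
    rank a         ≤⟨ ∑-monoʳ-≤ {n = a} (λ i _ → 𝟙≤1 (f i)) ⟩
    ∑[ i < a ] 1   ≡⟨ ∑-const a 1 ⟩
    a * 1          ≡⟨ *-identityʳ a ⟩
    a              ∎
    where open ≤-Reasoning

  ∑-by-rank : ∀ (h : ℕ → ℕ) m → ∑[ a < m ] (if f a then h (rank a) else 0) ≡ ∑[ j < rank m ] h j
  ∑-by-rank h zero    = refl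
  ∑-by-rank h (suc m) with f m
  ... | true  = trans (cong (_+ h (rank m)) (∑-by-rank h m)) (cong (λ t → ∑ t h) (+-comm 1 (rank m)))
  ... | false = trans (+-identityʳ _) (trans (∑-by-rank h m) (cong (λ t → ∑ t h) (sym (+-identityʳ (rank m)))))

module _ {A : Set} where

  length-filter≡sum : ∀ {P : Pred A 0ℓ} (P? : Decidable P) xs →
                      length (filter P? xs) ≡ sum (map (λ x → 𝟙 (does (P? x))) xs)
  length-filter≡sum P? []       = refl
  length-filter≡sum P? (x ∷ xs) with does (P? x)
  ... | true  = cong suc (length-filter≡sum P? xs)
  ... | false = length-filter≡sum P? xs

  sum-map-cong : ∀ {f g : A → ℕ} xs → (∀ {z} → z ∈ xs → f z ≡ g z) → sum (map f xs) ≡ sum (map g xs)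
  sum-map-cong xs f≡g = cong sum (map-cong-local (All.tabulate f≡g))

  sum-map-concatMap : ∀ {B : Set} (h : A → ℕ) (g : B → List A) ys →
                      sum (map h (concatMap g ys)) ≡ sum (map (λ y → sum (map h (g y))) ys)
  sum-map-concatMap h g []       = refl
  sum-map-concatMap h g (y ∷ ys) = begin
    sum (map h (g y ++ concatMap g ys))                  ≡⟨ cong sum (map-++ h (g y) _) ⟩
    sum (map h (g y) ++ map h (concatMap g ys))          ≡⟨ sum-++ (map h (g y)) _ ⟩
    sum (map h (g y)) + sum (map h (concatMap g ys))     ≡⟨ cong (sum (map h (g y)) +_) (sum-map-concatMap h g ys) ⟩
    sum (map h (g y)) + sum (map (λ y → sum (map h (g y))) ys) ∎
    where open ≡-Reasoning

  applyUpTo-+ : ∀ (f : ℕ → A) a b → applyUpTo f (a + b) ≡ applyUpTo f a ++ applyUpTo (λ i → f (a + i)) b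
  applyUpTo-+ f zero    b = refl
  applyUpTo-+ f (suc a) b = cong (f 0 ∷_) (applyUpTo-+ (f ∘ suc) a b)

  applyUpTo-cong : ∀ {f g : ℕ → A} n → (∀ i → f i ≡ g i) → applyUpTo f n ≡ applyUpTo g n
  applyUpTo-cong {f} {g} n f≡g = trans (sym (map-upTo f n)) (trans (map-cong f≡g (upTo n)) (map-upTo g n))

  applyUpTo-* : ∀ (f : ℕ → A) m P →
                applyUpTo f (m * P) ≡ concatMap (λ a → applyUpTo (λ c → f (a * P + c)) P) (upTo m)
  applyUpTo-* f zero    P = refl
  applyUpTo-* f (suc m) P = begin
    applyUpTo f (P + m * P)                                                   ≡⟨ applyUpTo-+ f P (m * P) ⟩
    applyUpTo f P ++ applyUpTo (λ i → f (P + i)) (m * P)                      ≡⟨ cong (applyUpTo f P ++_) (applyUpTo-* (λ i → f (P + i)) m P) ⟩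
    applyUpTo f P ++ concatMap (λ a → applyUpTo (λ c → f (P + (a * P + c))) P) (upTo m)
      ≡⟨ cong (applyUpTo f P ++_) (concatMap-cong (λ a → applyUpTo-cong P (λ c → cong f (sym (+-assoc P (a * P) c)))) (upTo m)) ⟩
    applyUpTo f P ++ concatMap (λ a → applyUpTo (λ c → f (suc a * P + c)) P) (upTo m)
      ≡⟨ cong (applyUpTo f P ++_) (concatMap-map (λ a → applyUpTo (λ c → f (a * P + c)) P) suc (upTo m)) ⟨
    applyUpTo f P ++ concatMap (λ a → applyUpTo (λ c → f (a * P + c)) P) (map suc (upTo m))
      ≡⟨ cong (λ as → applyUpTo f P ++ concatMap (λ a → applyUpTo (λ c → f (a * P + c)) P) as) (map-upTo suc m) ⟩
    concatMap (λ a → applyUpTo (λ c → f (a * P + c)) P) (upTo (suc m))       ∎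
    where open ≡-Reasoning

  nth : List A → ℕ → Maybe A
  nth []       _       = nothing
  nth (x ∷ xs) zero    = just x
  nth (x ∷ xs) (suc i) = nth xs i

  nth-applyUpTo : ∀ {c : A → ℕ} {g : ℕ → ℕ} {xs z} n → map c xs ≡ applyUpTo g n → z ∈ xs →
                  ∃ λ i → g i ≡ c z × nth xs i ≡ just z
  nth-applyUpTo {xs = x ∷ xs} (suc n) eq (here refl) = 0 , sym (proj₁ (∷-injective eq)) , refl
  nth-applyUpTo {xs = x ∷ xs} (suc n) eq (there z∈xs)
    with i , gi≡ , nth≡ ← nth-applyUpTo n (proj₂ (∷-injective eq)) z∈xs = suc i , gi≡ , nth≡

  nth-upTo : ∀ {c : A → ℕ} {xs z} n → map c xs ≡ upTo n → z ∈ xs → nth xs (c z) ≡ just z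
  nth-upTo n eq z∈xs with _ , refl , nth≡ ← nth-applyUpTo n eq z∈xs = nth≡

sum-upTo : ∀ n (f : ℕ → ℕ) → sum (map f (upTo n)) ≡ ∑ n f
sum-upTo zero    f = refl
sum-upTo (suc n) f = begin
  sum (map f (upTo (suc n)))        ≡⟨ cong (sum ∘ map f) (upTo-∷ʳ n) ⟨
  sum (map f (upTo n ∷ʳ n))         ≡⟨ cong sum (map-++ f (upTo n) [ n ]) ⟩
  sum (map f (upTo n) ++ [ f n ])   ≡⟨ sum-++ (map f (upTo n)) [ f n ] ⟩
  sum (map f (upTo n)) + (f n + 0)  ≡⟨ cong₂ _+_ (sum-upTo n f) (+-identityʳ (f n)) ⟩
  ∑ n f + f n                       ∎
  where open ≡-Reasoning

sum-map-upTo : ∀ {A : Set} {c : A → ℕ} {xs} n → map c xs ≡ upTo n → (f : ℕ → ℕ) → sum (map (f ∘ c) xs) ≡ ∑ n f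
sum-map-upTo {xs = xs} n eq f = trans (cong sum (map-∘ xs)) (trans (cong (sum ∘ map f) eq) (sum-upTo n f))

map-toℕ-allFin : ∀ n → map toℕ (allFin n) ≡ upTo n
map-toℕ-allFin n = trans (map-tabulate id toℕ) (go n id)
  where
  go : ∀ n (g : ℕ → ℕ) → tabulate {n = n} (g ∘ toℕ) ≡ applyUpTo g n
  go zero    g = refl
  go (suc n) g = cong (g 0 ∷_) (go n (g ∘ suc))

∈-mapMaybe⁺ : ∀ {A B : Set} {f : A → Maybe B} {xs z y} → z ∈ xs → f z ≡ just y → y ∈ mapMaybe f xs
∈-mapMaybe⁺ {f = f} {x ∷ xs} (here refl) fz≡ rewrite fz≡ = here refl
∈-mapMaybe⁺ {f = f} {x ∷ xs} (there z∈xs) fz≡ with f x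
... | just _  = there (∈-mapMaybe⁺ z∈xs fz≡)
... | nothing = ∈-mapMaybe⁺ z∈xs fz≡

-- Mixed-radix codes of indices

size : {d : ℕ} → Shape d → ℕ
size {zero}  s = 1
size {suc d} s = s zero * size (tail s)

code : {d : ℕ} (s : Shape d) → Idx s → ℕ
code {zero}  s x = 0
code {suc d} s x = toℕ (x zero) * size (tail s) + code (tail s) (λ i → x (suc i))

size-const : ∀ d n → size {d} (λ _ → n) ≡ n ^ d
size-const zero    n = refl
size-const (suc d) n = cong (n *_) (size-const d n)

code<size : ∀ {d} (s : Shape d) x → code s x < size s
code<size {zero}  s x = s≤s z≤n
code<size {suc d} s x = *+<* (toℕ<n (x zero)) (code<size (tail s) _)

code-injective : ∀ {d} (s : Shape d) x y → code s x ≡ code s y → ∀ i → x i ≡ y i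
code-injective {suc d} s x y eq i
  with x₀≡y₀ , rest≡ ← divMod-unique (toℕ (x zero)) (toℕ (y zero)) (code<size (tail s) _) (code<size (tail s) _) eq
  with i
... | zero  = toℕ-injective x₀≡y₀
... | suc i = code-injective (tail s) _ _ rest≡ i

map-code-allIdx : ∀ {d} (s : Shape d) → map (code s) (allIdx s) ≡ upTo (size s)
map-code-allIdx {zero}  s = refl
map-code-allIdx {suc d} s = begin
  map (code s) (allIdx s)
    ≡⟨ trans (map-concatMap (code s) _ (allFin (s zero)))
             (concatMap-cong (λ a → trans (sym (map-∘ R)) (row-codes (toℕ a))) (allFin (s zero))) ⟩
  concatMap ((λ a → applyUpTo (λ c → a * P + c) P) ∘ toℕ) (allFin (s zero))
    ≡⟨ concatMap-map _ toℕ (allFin (s zero)) ⟨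
  concatMap (λ a → applyUpTo (λ c → a * P + c) P) (map toℕ (allFin (s zero)))
    ≡⟨ cong (concatMap (λ a → applyUpTo (λ c → a * P + c) P)) (map-toℕ-allFin (s zero)) ⟩
  concatMap (λ a → applyUpTo (λ c → a * P + c) P) (upTo (s zero))
    ≡⟨ applyUpTo-* id (s zero) P ⟨
  upTo (s zero * P) ∎
  where
  open ≡-Reasoning
  P = size (tail s)
  R = allIdx (tail s)
  row-codes : ∀ a → map (λ r → a * P + code (tail s) r) R ≡ applyUpTo (a * P +_) P
  row-codes a = trans (map-∘ R) (trans (cong (map (a * P +_)) (map-code-allIdx (tail s))) (map-upTo (a * P +_) P))

sum-allIdx : ∀ {d} (s : Shape (suc d)) (G : ℕ → ℕ → ℕ) →
  sum (map (λ z → G (toℕ (z zero)) (code (tail s) (λ i → z (suc i)))) (allIdx s))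
    ≡ ∑[ a < s zero ] ∑[ c < size (tail s) ] G a c
sum-allIdx s G =
  trans (sum-map-concatMap _ _ (allFin (s zero)))
  (trans (cong sum (map-cong (λ a → trans (cong sum (sym (map-∘ R))) (row-sum (toℕ a))) (allFin (s zero))))
         (sum-map-upTo (s zero) (map-toℕ-allFin (s zero)) (λ a → ∑[ c < size (tail s) ] G a c)))
  where
  R = allIdx (tail s)
  row-sum : ∀ a → sum (map (λ r → G a (code (tail s) r)) R) ≡ ∑[ c < size (tail s) ] G a c
  row-sum a = sum-map-upTo (size (tail s)) (map-code-allIdx (tail s)) (G a)

Avoids-mono : ∀ {d} {s : Shape d} {F : Family d} {M M′ : Matrix s} →
              (∀ x → M′ x ≡ true → M x ≡ true) → Avoids F M → Avoids F M′
Avoids-mono M′⊆M avoids t P FP (f , increasing , P⊆M′) = avoids t P FP (f , increasing , λ x Px → M′⊆M _ (P⊆M′ x Px))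

-- The block construction

module Grouping {d′ n m : ℕ} (k′ : ℕ) (M : Matrix (shape d′ n m)) where

  k : ℕ
  k = suc k′

  s : Shape (suc d′)
  s = shape d′ n m

  U : List (Idx s)
  U = allIdx s

  N : ℕ
  N = size (tail s)

  col row : Idx s → ℕ
  col x = toℕ (x zero)
  row x = code (tail s) (λ i → x (suc i))

  _≟ᴹ_ : DecidableEquality (Maybe ℕ)
  _≟ᴹ_ = ≡-dec _≟_

  -- Reading M back through the enumeration allIdx makes entry (col z) (row z) literally
  -- M z for z ∈ U; an arbitrary index is only pointwise equal to such a z, and M need not
  -- respect pointwise equality. For the same reason A tests M x itself.
  entry : ℕ → ℕ → Bool
  entry a c = maybe′ M false (nth U (a * N + c))

  entry-U : ∀ {z} → z ∈ U → M z ≡ entry (col z) (row z)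
  entry-U z∈U = sym (cong (maybe′ M false) (nth-upTo (size s) (map-code-allIdx s) z∈U))

  rank : ℕ → ℕ → ℕ
  rank c = Rank.rank (λ a → entry a c)

  count : ℕ → ℕ
  count c = rank c m

  -- Block q of row c consists of the ones of rank qk, ..., qk + k - 1; when complete it is
  -- lettered q * N + c, whose remainder modulo N is the row.
  blockLetter : ℕ → ℕ → Maybe ℕ
  blockLetter c q with q <? count c / k
  ... | yes _ = just (q * N + c)
  ... | no  _ = nothing

  letterAt : ℕ → ℕ → Maybe ℕ
  letterAt a c = if entry a c then blockLetter c (rank c a / k) else nothing

  blockOf : Idx s → ℕ
  blockOf x = rank (row x) (col x) / k

  A : LetterArray s
  A x = if M x then blockLetter (row x) (blockOf x) else nothing

  A-U : ∀ {z} → z ∈ U → A z ≡ letterAt (col z) (row z)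
  A-U {z} z∈U rewrite entry-U z∈U = refl

  blockLetter-just : ∀ {c q ℓ} → blockLetter c q ≡ just ℓ → q < count c / k × q * N + c ≡ ℓ
  blockLetter-just {c} {q} eq with q <? count c / k
  ... | yes q< = q< , just-injective eq

  blockLetter-< : ∀ {c q} → q < count c / k → blockLetter c q ≡ just (q * N + c)
  blockLetter-< {c} {q} q< with q <? count c / k
  ... | yes _  = refl
  ... | no q≮ = ⊥-elim (q≮ q<)

  A-just : ∀ {x ℓ} → A x ≡ just ℓ → blockLetter (row x) (blockOf x) ≡ just ℓ
  A-just {x} eq with M x
  ... | true = eq

  k≤occurrences-in-row : ∀ {c q ℓ} → blockLetter c q ≡ just ℓ → k ≤ ∑[ a < m ] 𝟙 (does (letterAt a c ≟ᴹ just ℓ))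
  k≤occurrences-in-row {c} {q} {ℓ} eq = begin
    k                                                            ≤⟨ ∑-window (q * k) k (count c) window≤count
                                                                      (λ i i<k → cong 𝟙 (dec-true (_ ≟ᴹ just ℓ) (in-block i<k))) ⟩
    ∑[ j < count c ] 𝟙 (does (blockLetter c (j / k) ≟ᴹ just ℓ))  ≡⟨ Rank.∑-by-rank (λ a → entry a c) _ m ⟨
    ∑[ a < m ] (if entry a c then 𝟙 (does (blockLetter c (rank c a / k) ≟ᴹ just ℓ)) else 0)
                                                                 ≡⟨ ∑-cong {n = m} (λ a _ → 𝟙-if (entry a c) _) ⟩
    ∑[ a < m ] 𝟙 (does (letterAt a c ≟ᴹ just ℓ))                 ∎
    where
    open ≤-Reasoning
    window≤count : q * k + k ≤ count c
    window≤count = begin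
      q * k + k        ≡⟨ +-comm (q * k) k ⟩
      suc q * k        ≤⟨ *-monoˡ-≤ k (proj₁ (blockLetter-just eq)) ⟩
      count c / k * k  ≤⟨ m/n*n≤m (count c) k ⟩
      count c          ∎
    in-block : ∀ {i} → i < k → blockLetter c ((q * k + i) / k) ≡ just ℓ
    in-block i<k = trans (cong (blockLetter c) ([m*n+o]/n≡m q i<k)) eq
    𝟙-if : ∀ b (x : Maybe ℕ) → (if b then 𝟙 (does (x ≟ᴹ just ℓ)) else 0)
                               ≡ 𝟙 (does ((if b then x else nothing) ≟ᴹ just ℓ))
    𝟙-if true  x = refl
    𝟙-if false x = refl

  occurrences≡ : ∀ ℓ → occurrences A ℓ ≡ ∑[ a < m ] ∑[ c < N ] 𝟙 (does (letterAt a c ≟ᴹ just ℓ))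
  occurrences≡ ℓ =
    trans (length-filter≡sum (λ x → A x ≟ᴹ just ℓ) U)
    (trans (sum-map-cong U (λ z∈U → cong (λ y → 𝟙 (does (y ≟ᴹ just ℓ))) (A-U z∈U)))
           (sum-allIdx s (λ a c → 𝟙 (does (letterAt a c ≟ᴹ just ℓ)))))

  ones≡ : ones M ≡ ∑[ c < N ] count c
  ones≡ =
    trans (length-filter≡sum (λ x → T? (M x)) U)
    (trans (sum-map-cong U (λ z∈U → cong 𝟙 (entry-U z∈U)))
    (trans (sum-allIdx s (λ a c → 𝟙 (entry a c)))
           (∑-comm m N (λ a c → 𝟙 (entry a c)))))

  ∈-U : ∀ {a c} → a < m → c < N → ∃ λ z → z ∈ U × col z ≡ a × row z ≡ c
  ∈-U {a} {c} a<m c<N with z , z∈U , code≡ ← ∈-map⁻ (code s) (subst (a * N + c ∈_) (sym (map-code-allIdx s)) (∈-upTo⁺ (*+<* a<m c<N)))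
    with refl , refl ← divMod-unique a (col z) c<N (code<size (tail s) _) code≡ = z , z∈U , refl , refl

  has-k-occurrences : ∀ x ℓ → A x ≡ just ℓ → k ≤ occurrences A ℓ
  has-k-occurrences x ℓ Ax≡ = begin
    k                                                  ≤⟨ k≤occurrences-in-row ((A-just Ax≡)) ⟩
    ∑[ a < m ] 𝟙 (does (letterAt a (row x) ≟ᴹ just ℓ))  ≤⟨ ∑-monoʳ-≤ {n = m} (λ a _ → ≤-∑ _ (code<size (tail s) _)) ⟩
    ∑[ a < m ] ∑[ c < N ] 𝟙 (does (letterAt a c ≟ᴹ just ℓ)) ≡⟨ occurrences≡ ℓ ⟨
    occurrences A ℓ                                    ∎
    where open ≤-Reasoning

  same-row : ∀ x y ℓ → A x ≡ just ℓ → A y ≡ just ℓ → ∀ i → x (suc i) ≡ y (suc i)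
  same-row x y ℓ Ax≡ Ay≡
    with _ , ℓ≡x ← blockLetter-just ((A-just Ax≡)) | _ , ℓ≡y ← blockLetter-just ((A-just Ay≡))
    with _ , row≡ ← divMod-unique (blockOf x) (blockOf y) (code<size (tail s) _) (code<size (tail s) _) (trans ℓ≡x (sym ℓ≡y))
    = code-injective (tail s) _ _ row≡

  valid : ∀ {F} → Avoids F M → ValidLx d′ k F A
  valid avoids = has-k-occurrences , same-row , Avoids-mono underlying-⊆ avoids
    where
    underlying-⊆ : ∀ x → underlying A x ≡ true → M x ≡ true
    underlying-⊆ x _ with M x
    ... | true = refl

  blockLetter-occurs : ∀ c q → c < N → q < count c / k → q * N + c ∈ mapMaybe A U
  blockLetter-occurs c q c<N q<
    with a , a<m , 0<𝟙 ← ∑-positive m _ (≤-trans (s≤s z≤n) (k≤occurrences-in-row (blockLetter-< q<)))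
    with z , z∈U , refl , refl ← ∈-U a<m c<N
    = ∈-mapMaybe⁺ z∈U (trans (A-U z∈U) (𝟙-positive (letterAt a c ≟ᴹ _) 0<𝟙))

  blocks≤distinctLetters : ∑[ c < N ] (count c / k) ≤ distinctLetters A
  blocks≤distinctLetters = ∑-≤-length (λ c → count c / k) (deduplicate _≟_ (mapMaybe A U))
    (λ c _ → ≤-trans (m/n≤m (count c) k) (Rank.rank≤ (λ a → entry a c) m))
    (λ c q c<N q< → ∈-deduplicate⁺ _≟_ (blockLetter-occurs c q c<N q<))

  ones≤ : ones M ≤ k * ∑[ c < N ] (count c / k) + N * k
  ones≤ = begin
    ones M                                       ≡⟨ ones≡ ⟩
    ∑[ c < N ] count c                           ≤⟨ ∑-monoʳ-≤ {n = N} (λ c _ → m≤n*[m/n]+n (count c) k) ⟩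
    ∑[ c < N ] (k * (count c / k) + k)           ≡⟨ ∑-distrib-+ N _ _ ⟩
    ∑[ c < N ] (k * (count c / k)) + ∑[ c < N ] k ≡⟨ cong₂ _+_ (sym (*-distribˡ-∑ k N _)) (∑-const N k) ⟩
    k * ∑[ c < N ] (count c / k) + N * k         ∎
    where open ≤-Reasoning

lemma3 : (d' : ℕ) (F : Family (suc d')) (n m k : ℕ) → 0 < n → 0 < m → 0 < k →
    (e l : ℕ) → IsEx d' n m F e → IsLx d' n m k F l →
    e ≤ k * (l + n ^ d')
lemma3 d' F n m (suc k′) _ _ _ e l ((M , avoids , ones≡e) , _) (_ , lx-max) = begin
  e                                          ≡⟨ ones≡e ⟨
  ones M                                     ≤⟨ ones≤ ⟩
  k * ∑[ c < N ] (count c / k) + N * k       ≤⟨ +-monoˡ-≤ (N * k) (*-monoʳ-≤ k blocks≤l) ⟩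
  k * l + N * k                              ≡⟨ cong (λ t → k * l + t * k) (size-const d' n) ⟩
  k * l + n ^ d' * k                         ≡⟨ cong (k * l +_) (*-comm (n ^ d') k) ⟩
  k * l + k * n ^ d'                         ≡⟨ *-distribˡ-+ k l (n ^ d') ⟨
  k * (l + n ^ d')                           ∎
  where
  open Grouping k′ M
  open ≤-Reasoning
  blocks≤l : ∑[ c < N ] (count c / k) ≤ l
  blocks≤l = ≤-trans blocks≤distinctLetters (lx-max _ (A , valid avoids , refl))
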